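{- Let $t\geq 3$ be an integer and suppose that every $PG(t-2,2)$-free matroid $M'$ with $|M'|>(1-3\cdot 2^{ -(t-1)})2^{r(M')}$ satisfies $\chi(M')\in\{t-2,t-1\}$. Let $M$ be a $PG(t-1,2)$-free matroid with $|M|>(1-3\cdot 2^{ -t})2^{r(M)}$ and $\chi(M)>t$, and set $Y=\mathbb{F}_2^{r(M)}\setminus E(M)$. Then for every hyperplane $H$ of $\mathbb{F}_2^{r(M)}$, $|Y\cap H|\geq 2^{r(M)-t}$.
   Context: A matroid $M$ means a simple binary matroid, represented by an integer $r(M)\geq 0$ (its rank) and a set $E(M)\subseteq \mathbb{F}_2^{r(M)}\setminus\{0\}$ that spans $\mathbb{F}_2^{r(M)}$; $|M|:=|E(M)|$. The critical number $\chi(M)$ is the smallest $k$ such that some subspace of $\mathbb{F}_2^{r(M)}$ of codimension $k$ is disjoint from $E(M)$. A matroid $M$ contains a matroid $N$ if there is an injective linear map $\iota:\mathbb{F}_2^{r(N)}\to\mathbb{F}_2^{r(M)}$ with $\iota(E(N))\subseteq E(M)$; $M$ is $N$-free if it does not contain $N$. The projective geometry $PG(s-1,2)$ is the matroid of rank $s$ with edge set $\mathbb{F}_2^s\setminus\{0\}$. A hyperplane is a linear subspace of codimension 1. -}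

module Defs where

open import Data.Nat using (ℕ; zero; suc; _+_; _*_; _^_; _<_; _≤_)
open import Data.Bool using (Bool; true; false; _xor_; _∧_; if_then_else_; not)
open import Data.Vec using (Vec; []; _∷_)
open import Data.List using (List; []; _∷_; _++_; map)
open import Data.Nat.ListAction using (sum)
open import Data.List.Relation.Unary.All as All using (All)
open import Data.Product using (Σ; _×_; ∃; _,_)
open import Data.Unit using (⊤)
open import Relation.Binary.PropositionalEquality using (_≡_; _≢_; refl; sym; cong)
open import Relation.Nullary using (¬_)

-- Vectors of F₂^n are  Vec Bool n  (true = 1).

0ᵥ : (n : ℕ) → Vec Bool n
0ᵥ zero    = []
0ᵥ (suc n) = false ∷ 0ᵥ n

_⊕_ : ∀ {n} → Vec Bool n → Vec Bool n → Vec Bool n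
[]       ⊕ []       = []
(x ∷ xs) ⊕ (y ∷ ys) = (x xor y) ∷ (xs ⊕ ys)

dot : ∀ {n} → Vec Bool n → Vec Bool n → Bool
dot []       []       = false
dot (x ∷ xs) (y ∷ ys) = (x ∧ y) xor dot xs ys

sumᵥ : ∀ {n} → List (Vec Bool n) → Vec Bool n
sumᵥ {n} []       = 0ᵥ n
sumᵥ     (v ∷ vs) = v ⊕ sumᵥ vs

-- linear combination  Σ c_i b_i  of a family  b : Vec (Vec Bool r) s  with coefficients c ∈ F₂^s
-- (this is the linear map F₂^s → F₂^r whose matrix has columns b_i)
comb : ∀ {r s} → Vec (Vec Bool r) s → Vec Bool s → Vec Bool r
comb {r} []       []       = 0ᵥ r
comb     (b ∷ bs) (c ∷ cs) = if c then b ⊕ comb bs cs else comb bs cs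

LinIndep : ∀ {r s} → Vec (Vec Bool r) s → Set
LinIndep {r} {s} bs = (c : Vec Bool s) → comb bs c ≡ 0ᵥ r → c ≡ 0ᵥ s

allVecs : (n : ℕ) → List (Vec Bool n)
allVecs zero    = [] ∷ []
allVecs (suc n) = map (false ∷_) (allVecs n) ++ map (true ∷_) (allVecs n)

count : ∀ {n} → (Vec Bool n → Bool) → ℕ
count {n} p = sum (map (λ v → if p v then 1 else 0) (allVecs n))

-- A simple binary matroid: rank r and E ⊆ F₂^r ∖ {0} (given by its
-- characteristic function) spanning F₂^r.
record Matroid : Set where
  field
    rank    : ℕ
    E       : Vec Bool rank → Bool
    zero∉E  : E (0ᵥ rank) ≡ false
    spans   : (v : Vec Bool rank) →
              Σ (List (Vec Bool rank)) λ xs → All (λ x → E x ≡ true) xs × sumᵥ xs ≡ v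
open Matroid public

size : Matroid → ℕ
size M = count (E M)

-- A subspace of codimension k in F₂^r is exactly the common kernel of k
-- linearly independent functionals x ↦ a_i · x.
inKernel : ∀ {r k} → Vec (Vec Bool r) k → Vec Bool r → Set
inKernel []       x = ⊤
inKernel (a ∷ as) x = dot a x ≡ false × inKernel as x

HasDisjointSubspaceOfCodim : Matroid → ℕ → Set
HasDisjointSubspaceOfCodim M k =
  Σ (Vec (Vec Bool (rank M)) k) λ as →
    LinIndep as × ((x : Vec Bool (rank M)) → inKernel as x → E M x ≡ false)

IsCriticalNumber : Matroid → ℕ → Set
IsCriticalNumber M k =
  HasDisjointSubspaceOfCodim M k × ((j : ℕ) → j < k → ¬ HasDisjointSubspaceOfCodim M j)

-- M contains N: injective linear map ι : F₂^{r(N)} → F₂^{r(M)} with ι(E(N)) ⊆ E(M).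
-- ι is given by the images of the standard basis vectors (columns), injectivity
-- = linear independence of these columns.
Contains : Matroid → Matroid → Set
Contains M N =
  Σ (Vec (Vec Bool (rank M)) (rank N)) λ ι →
    LinIndep ι × ((x : Vec Bool (rank N)) → E N x ≡ true → E M (comb ι x) ≡ true)

Free : Matroid → Matroid → Set
Free M N = ¬ Contains M N

isZero : ∀ {n} → Vec Bool n → Bool
isZero []           = true
isZero (true ∷ xs)  = false
isZero (false ∷ xs) = isZero xs

private
  isZero-0 : (n : ℕ) → isZero (0ᵥ n) ≡ true
  isZero-0 zero    = refl
  isZero-0 (suc n) = isZero-0 n

  ⊕-0 : ∀ {n} (v : Vec Bool n) → v ⊕ 0ᵥ n ≡ v
  ⊕-0 []          = refl
  ⊕-0 (false ∷ v) = cong (false ∷_) (⊕-0 v)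
  ⊕-0 (true ∷ v)  = cong (true ∷_) (⊕-0 v)

  isZero-sound : ∀ {n} (v : Vec Bool n) → isZero v ≡ true → v ≡ 0ᵥ n
  isZero-sound []          _  = refl
  isZero-sound (false ∷ v) eq = cong (false ∷_) (isZero-sound v eq)
  isZero-sound (true ∷ v)  ()

  pgSpans : (s : ℕ) (v : Vec Bool s) →
            Σ (List (Vec Bool s)) λ xs → All (λ x → not (isZero x) ≡ true) xs × sumᵥ xs ≡ v
  pgSpans s v with isZero v in eq
  ... | true  = [] , (All.[] , sym (isZero-sound v eq))
  ... | false = (v ∷ []) , ((cong not eq All.∷ All.[]) , ⊕-0 v)

-- PG s  denotes  PG(s-1, 2)
PG : ℕ → Matroid
PG s = record
  { rank   = s
  ; E      = λ x → not (isZero x)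
  ; zero∉E = cong not (isZero-0 s)
  ; spans  = pgSpans s
  }

-- Suppose Y = F₂^r ∖ E(M) meets the hyperplane H = a^⊥ in fewer than 2^(r-t) points.
-- Then the restriction M|H misses fewer than 2^((r-1)-(t-1)) points of H; this makes it
-- spanning and dense enough for the hypothesis on rank-(t-1) geometries. It is also
-- PG(t-2,2)-free: if W ∖ {0} ⊆ E(M|H) for a (t-1)-dimensional W, a union bound over the
-- 2^(t-1) points of W finds u with u + W ⊆ E(M|H), and (W ∪ (u + W)) ∖ {0} is a PG(t-1,2)
-- in M. So χ(M|H) ≤ t-1, and adding the functional a to a subspace of H disjoint from
-- E(M|H) gives χ(M) ≤ t, a contradiction.
module Submission where

open import Defs
open import Data.Nat using (ℕ; zero; suc; pred; _+_; _*_; _^_; _∸_; _<_; _≤_; _<?_; s≤s; z≤n)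
open import Data.Nat.Properties
open import Data.Nat.Induction using (<-rec)
open import Data.Nat.ListAction using (sum)
open import Data.Nat.ListAction.Properties using (sum-++)
open import Data.Bool using (Bool; true; false; not; _∧_; _∨_; _xor_; if_then_else_)
open import Data.Bool.Properties
  using (xor-same; xor-assoc; xor-identityʳ; ∧-distribˡ-xor; ∧-identityʳ; ∧-zeroʳ;
         ∨-conicalˡ; ∨-conicalʳ; not-injective; xor-∧-commutativeRing)
open import Data.Vec using (Vec; []; _∷_; map; head)
open import Data.List using (List; []; _∷_)
import Data.List as List
open import Data.List.Properties using (map-++; map-∘)
open import Data.List.Relation.Unary.All using (All; []; _∷_)
open import Data.Product using (Σ; ∃; _×_; _,_; proj₁; proj₂)
open import Data.Sum using (_⊎_; [_,_]′)
open import Data.Unit using (tt)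
open import Data.Empty using (⊥-elim)
open import Function using (_∘_)
open import Relation.Binary.PropositionalEquality
open import Relation.Nullary using (¬_; yes; no; contradiction)
open import Algebra.Bundles using (CommutativeRing)
open import Algebra.Properties.CommutativeSemigroup +-commutativeSemigroup
  using () renaming (interchange to +-interchange)
open import Algebra.Properties.CommutativeSemigroup
  (CommutativeRing.+-commutativeSemigroup xor-∧-commutativeRing)
  using () renaming (interchange to xor-interchange)

⊕-identityˡ : ∀ {n} (v : Vec Bool n) → 0ᵥ n ⊕ v ≡ v
⊕-identityˡ []      = refl
⊕-identityˡ (b ∷ v) = cong (b ∷_) (⊕-identityˡ v)

⊕-identityʳ : ∀ {n} (v : Vec Bool n) → v ⊕ 0ᵥ n ≡ v
⊕-identityʳ []      = refl
⊕-identityʳ (b ∷ v) = cong₂ _∷_ (xor-identityʳ b) (⊕-identityʳ v)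

⊕-self : ∀ {n} (v : Vec Bool n) → v ⊕ v ≡ 0ᵥ n
⊕-self []      = refl
⊕-self (b ∷ v) = cong₂ _∷_ (xor-same b) (⊕-self v)

⊕-assoc : ∀ {n} (x y z : Vec Bool n) → (x ⊕ y) ⊕ z ≡ x ⊕ (y ⊕ z)
⊕-assoc []      []      []      = refl
⊕-assoc (a ∷ x) (b ∷ y) (c ∷ z) = cong₂ _∷_ (xor-assoc a b c) (⊕-assoc x y z)

⊕-cancelˡ : ∀ {n} (x y : Vec Bool n) → x ⊕ (x ⊕ y) ≡ y
⊕-cancelˡ {n} x y = begin
  x ⊕ (x ⊕ y) ≡⟨ ⊕-assoc x x y ⟨
  (x ⊕ x) ⊕ y ≡⟨ cong (_⊕ y) (⊕-self x) ⟩
  0ᵥ n ⊕ y    ≡⟨ ⊕-identityˡ y ⟩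
  y           ∎
  where open ≡-Reasoning

⊕≡0⇒≡ : ∀ {n} {x y : Vec Bool n} → x ⊕ y ≡ 0ᵥ n → x ≡ y
⊕≡0⇒≡ {n} {x} {y} x⊕y≡0 = begin
  x           ≡⟨ ⊕-identityʳ x ⟨
  x ⊕ 0ᵥ n    ≡⟨ cong (x ⊕_) x⊕y≡0 ⟨
  x ⊕ (x ⊕ y) ≡⟨ ⊕-cancelˡ x y ⟩
  y           ∎
  where open ≡-Reasoning

dot-⊕ : ∀ {n} (a x y : Vec Bool n) → dot a (x ⊕ y) ≡ dot a x xor dot a y
dot-⊕ []       []       []       = refl
dot-⊕ (a ∷ as) (x ∷ xs) (y ∷ ys) = begin
  (a ∧ (x xor y)) xor dot as (xs ⊕ ys)
    ≡⟨ cong₂ _xor_ (∧-distribˡ-xor a x y) (dot-⊕ as xs ys) ⟩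
  ((a ∧ x) xor (a ∧ y)) xor (dot as xs xor dot as ys)
    ≡⟨ xor-interchange (a ∧ x) (a ∧ y) (dot as xs) (dot as ys) ⟩
  ((a ∧ x) xor dot as xs) xor ((a ∧ y) xor dot as ys)
    ∎
  where open ≡-Reasoning

Linear : ∀ {m n} → (Vec Bool m → Vec Bool n) → Set
Linear f = ∀ x y → f (x ⊕ y) ≡ f x ⊕ f y

TrivialKernel : ∀ {m n} → (Vec Bool m → Vec Bool n) → Set
TrivialKernel {m} {n} f = ∀ x → f x ≡ 0ᵥ n → x ≡ 0ᵥ m

linear-0 : ∀ {m n} {f : Vec Bool m → Vec Bool n} → Linear f → f (0ᵥ m) ≡ 0ᵥ n
linear-0 {m} {f = f} lin = begin
  f (0ᵥ m)              ≡⟨ cong f (⊕-self (0ᵥ m)) ⟨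
  f (0ᵥ m ⊕ 0ᵥ m)       ≡⟨ lin (0ᵥ m) (0ᵥ m) ⟩
  f (0ᵥ m) ⊕ f (0ᵥ m)   ≡⟨ ⊕-self (f (0ᵥ m)) ⟩
  0ᵥ _                  ∎
  where open ≡-Reasoning

comb-map : ∀ {m n s} {f : Vec Bool m → Vec Bool n} → Linear f →
           (bs : Vec (Vec Bool m) s) (c : Vec Bool s) → comb (map f bs) c ≡ f (comb bs c)
comb-map lin []       []          = sym (linear-0 lin)
comb-map lin (b ∷ bs) (false ∷ c) = comb-map lin bs c
comb-map {f = f} lin (b ∷ bs) (true ∷ c) =
  trans (cong (f b ⊕_) (comb-map lin bs c)) (sym (lin b (comb bs c)))

LinIndep-map : ∀ {m n s} {f : Vec Bool m → Vec Bool n} → Linear f → TrivialKernel f →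
               (bs : Vec (Vec Bool m) s) → LinIndep bs → LinIndep (map f bs)
LinIndep-map lin ker bs indep c fbs·c≡0 =
  indep c (ker (comb bs c) (trans (sym (comb-map lin bs c)) fbs·c≡0))

indicator : Bool → ℕ
indicator b = if b then 1 else 0

-- Structurally recursive in n, unlike  count.
card : ∀ n → (Vec Bool n → Bool) → ℕ
card zero    p = indicator (p [])
card (suc n) p = card n (p ∘ (false ∷_)) + card n (p ∘ (true ∷_))

count≡card : ∀ {n} (p : Vec Bool n → Bool) → count p ≡ card n p
count≡card {zero}  p = +-identityʳ (indicator (p []))
count≡card {suc n} p = begin
  sum (List.map f (List.map (false ∷_) A List.++ List.map (true ∷_) A))
    ≡⟨ cong sum (map-++ f (List.map (false ∷_) A) (List.map (true ∷_) A)) ⟩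
  sum (List.map f (List.map (false ∷_) A) List.++ List.map f (List.map (true ∷_) A))
    ≡⟨ sum-++ (List.map f (List.map (false ∷_) A)) _ ⟩
  sum (List.map f (List.map (false ∷_) A)) + sum (List.map f (List.map (true ∷_) A))
    ≡⟨ cong₂ _+_ (cong sum (map-∘ A)) (cong sum (map-∘ A)) ⟨
  count (p ∘ (false ∷_)) + count (p ∘ (true ∷_))
    ≡⟨ cong₂ _+_ (count≡card (p ∘ (false ∷_))) (count≡card (p ∘ (true ∷_))) ⟩
  card (suc n) p
    ∎
  where
  open ≡-Reasoning
  A : List (Vec Bool n)
  A = allVecs n
  f : Vec Bool (suc n) → ℕ
  f v = indicator (p v)

card-+ : ∀ n {f g h : Vec Bool n → Bool} →
         (∀ v → indicator (f v) + indicator (g v) ≡ indicator (h v)) →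
         card n f + card n g ≡ card n h
card-+ zero    pointwise = pointwise []
card-+ (suc n) pointwise = trans
  (+-interchange (card n _) (card n _) (card n _) (card n _))
  (cong₂ _+_ (card-+ n (pointwise ∘ (false ∷_))) (card-+ n (pointwise ∘ (true ∷_))))

card-∨ : ∀ n (p q : Vec Bool n → Bool) → card n (λ v → p v ∨ q v) ≤ card n p + card n q
card-∨ zero p q with p [] | q []
... | true  | _     = s≤s z≤n
... | false | true  = s≤s z≤n
... | false | false = z≤n
card-∨ (suc n) p q = ≤-trans
  (+-mono-≤ (card-∨ n (p ∘ (false ∷_)) (q ∘ (false ∷_)))
            (card-∨ n (p ∘ (true ∷_)) (q ∘ (true ∷_))))
  (≤-reflexive (+-interchange (card n _) (card n _) (card n _) (card n _)))

card-⊕ : ∀ n (p : Vec Bool n → Bool) (v : Vec Bool n) →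
         card n (λ x → p (x ⊕ v)) ≡ card n p
card-⊕ zero    p []          = refl
card-⊕ (suc n) p (false ∷ v) =
  cong₂ _+_ (card-⊕ n (p ∘ (false ∷_)) v) (card-⊕ n (p ∘ (true ∷_)) v)
card-⊕ (suc n) p (true ∷ v)  = trans
  (cong₂ _+_ (card-⊕ n (p ∘ (true ∷_)) v) (card-⊕ n (p ∘ (false ∷_)) v))
  (+-comm (card n (p ∘ (true ∷_))) (card n (p ∘ (false ∷_))))

card-complement : ∀ n (p : Vec Bool n → Bool) → card n p + card n (not ∘ p) ≡ 2 ^ n
card-complement n p = trans (card-+ n (excluded-middle ∘ p)) (card-true n)
  where
  excluded-middle : ∀ b → indicator b + indicator (not b) ≡ 1
  excluded-middle true  = refl
  excluded-middle false = refl
  card-true : ∀ n → card n (λ _ → true) ≡ 2 ^ n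
  card-true zero    = refl
  card-true (suc n) = cong₂ _+_ (card-true n) (trans (card-true n) (sym (+-identityʳ (2 ^ n))))

card<2^n⇒∃false : ∀ n (p : Vec Bool n → Bool) → card n p < 2 ^ n → ∃ λ v → p v ≡ false
card<2^n⇒∃false zero p few with p [] in eq
... | true  = contradiction few (<-irrefl refl)
... | false = [] , eq
card<2^n⇒∃false (suc n) p few with card n (p ∘ (false ∷_)) <? 2 ^ n
... | yes few₀ = let v , eq = card<2^n⇒∃false n (p ∘ (false ∷_)) few₀ in false ∷ v , eq
... | no ¬few₀ = let v , eq = card<2^n⇒∃false n (p ∘ (true ∷_)) few₁ in true ∷ v , eq
  where
  few₁ : card n (p ∘ (true ∷_)) < 2 ^ n
  few₁ = +-cancelˡ-< (2 ^ n) _ _ (begin-strict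
    2 ^ n + card n (p ∘ (true ∷_))                      ≤⟨ +-monoˡ-≤ _ (≮⇒≥ ¬few₀) ⟩
    card n (p ∘ (false ∷_)) + card n (p ∘ (true ∷_))   <⟨ few ⟩
    2 ^ n + (2 ^ n + 0)                                 ≡⟨ cong (2 ^ n +_) (+-identityʳ (2 ^ n)) ⟩
    2 ^ n + 2 ^ n                                       ∎)
    where open ≤-Reasoning

anyᵥ : ∀ d → (Vec Bool d → Bool) → Bool
anyᵥ zero    f = f []
anyᵥ (suc d) f = anyᵥ d (f ∘ (false ∷_)) ∨ anyᵥ d (f ∘ (true ∷_))

anyᵥ≡false : ∀ d {f : Vec Bool d → Bool} → anyᵥ d f ≡ false → ∀ c → f c ≡ false
anyᵥ≡false zero    none []          = none
anyᵥ≡false (suc d) none (false ∷ c) = anyᵥ≡false d (∨-conicalˡ _ _ none) c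
anyᵥ≡false (suc d) none (true ∷ c)  = anyᵥ≡false d (∨-conicalʳ _ _ none) c

card-anyᵥ : ∀ n d (g : Vec Bool n → Vec Bool d → Bool) (K : ℕ) →
            (∀ c → card n (λ u → g u c) ≤ K) → card n (λ u → anyᵥ d (g u)) ≤ 2 ^ d * K
card-anyᵥ n zero    g K bound = ≤-trans (bound []) (≤-reflexive (sym (+-identityʳ K)))
card-anyᵥ n (suc d) g K bound = begin
  card n (λ u → anyᵥ (suc d) (g u))
    ≤⟨ card-∨ n _ _ ⟩
  card n (λ u → anyᵥ d (g u ∘ (false ∷_))) + card n (λ u → anyᵥ d (g u ∘ (true ∷_)))
    ≤⟨ +-mono-≤ (card-anyᵥ n d _ K (bound ∘ (false ∷_)))
                (card-anyᵥ n d _ K (bound ∘ (true ∷_))) ⟩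
  2 ^ d * K + 2 ^ d * K
    ≡⟨ cong (2 ^ d * K +_) (+-identityʳ (2 ^ d * K)) ⟨
  2 * (2 ^ d * K)
    ≡⟨ *-assoc 2 (2 ^ d) K ⟨
  2 ^ suc d * K
    ∎
  where open ≤-Reasoning

-- Union bound over the 2^d values of c.
∃-avoiding : ∀ {n d} (g : Vec Bool n → Vec Bool d → Bool) {K : ℕ} →
             (∀ c → card n (λ u → g u c) ≤ K) → K * 2 ^ d < 2 ^ n →
             ∃ λ u → ∀ c → g u c ≡ false
∃-avoiding {n} {d} g {K} bound few =
  let u , none = card<2^n⇒∃false n _
                   (≤-<-trans (card-anyᵥ n d g K bound) (subst (_< 2 ^ n) (*-comm K (2 ^ d)) few))
  in u , anyᵥ≡false d none

-- A witness that  a ≠ 0:  the position of its first nonzero coordinate.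
data Pivot : ∀ {r} → Vec Bool r → Set where
  here  : ∀ {n} {v : Vec Bool n} → Pivot (true ∷ v)
  there : ∀ {n} {v : Vec Bool (suc n)} → Pivot v → Pivot (false ∷ v)

pivot : ∀ {r} (a : Vec Bool r) → a ≢ 0ᵥ r → Pivot a
pivot []                  a≢0 = contradiction refl a≢0
pivot (true ∷ a)          _   = here
pivot (false ∷ [])        a≢0 = contradiction refl a≢0
pivot (false ∷ a@(_ ∷ _)) a≢0 = there (pivot a (a≢0 ∘ cong (false ∷_)))

2^-pivot : ∀ {r} {a : Vec Bool r} → Pivot a → 2 ^ r ≡ 2 * 2 ^ pred r
2^-pivot here      = refl
2^-pivot (there _) = refl

-- Parametrises  a^⊥  by the coordinates off the pivot, solving for the pivot coordinate.
hyperplane : ∀ {r} {a : Vec Bool r} → Pivot a → Vec Bool (pred r) → Vec Bool r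
hyperplane (here {v = a}) y      = dot a y ∷ y
hyperplane (there z)     (b ∷ y) = b ∷ hyperplane z y

-- Extends a functional on  a^⊥  (in the coordinates of  hyperplane)  by 0 at the pivot.
extend : ∀ {r} {a : Vec Bool r} → Pivot a → Vec Bool (pred r) → Vec Bool r
extend here      β       = false ∷ β
extend (there z) (b ∷ β) = b ∷ extend z β

xor≡false⇒≡ : ∀ a b → a xor b ≡ false → a ≡ b
xor≡false⇒≡ false false _ = refl
xor≡false⇒≡ true  true  _ = refl

∷-injectiveʳ : ∀ {n} {a b : Bool} {x y : Vec Bool n} → a ∷ x ≡ b ∷ y → x ≡ y
∷-injectiveʳ refl = refl

hyperplane-linear : ∀ {r} {a : Vec Bool r} (z : Pivot a) → Linear (hyperplane z)
hyperplane-linear (here {v = a}) x y             = cong (_∷ (x ⊕ y)) (dot-⊕ a x y)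
hyperplane-linear (there z)     (b ∷ x) (c ∷ y) = cong ((b xor c) ∷_) (hyperplane-linear z x y)

hyperplane-kernel : ∀ {r} {a : Vec Bool r} (z : Pivot a) → TrivialKernel (hyperplane z)
hyperplane-kernel here      y       eq = ∷-injectiveʳ eq
hyperplane-kernel (there z) (b ∷ y) eq =
  cong₂ _∷_ (cong head eq) (hyperplane-kernel z y (∷-injectiveʳ eq))

hyperplane-surjective : ∀ {r} {a : Vec Bool r} (z : Pivot a) (x : Vec Bool r) →
                        dot a x ≡ false → ∃ λ y → hyperplane z y ≡ x
hyperplane-surjective (here {v = a}) (b ∷ x) a·x≡0 =
  x , cong (_∷ x) (sym (xor≡false⇒≡ b _ a·x≡0))
hyperplane-surjective (there z) (b ∷ x) a·x≡0 =
  let y , eq = hyperplane-surjective z x a·x≡0 in b ∷ y , cong (b ∷_) eq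

extend-linear : ∀ {r} {a : Vec Bool r} (z : Pivot a) → Linear (extend z)
extend-linear here      x       y       = refl
extend-linear (there z) (b ∷ x) (c ∷ y) = cong ((b xor c) ∷_) (extend-linear z x y)

extend-kernel : ∀ {r} {a : Vec Bool r} (z : Pivot a) → TrivialKernel (extend z)
extend-kernel here      β       eq = ∷-injectiveʳ eq
extend-kernel (there z) (b ∷ β) eq =
  cong₂ _∷_ (cong head eq) (extend-kernel z β (∷-injectiveʳ eq))

extend≢ : ∀ {r} {a : Vec Bool r} (z : Pivot a) (β : Vec Bool (pred r)) → extend z β ≢ a
extend≢ here      β       ()
extend≢ (there z) (b ∷ β) eq = extend≢ z β (∷-injectiveʳ eq)

dot-extend-hyperplane : ∀ {r} {a : Vec Bool r} (z : Pivot a) (β y : Vec Bool (pred r)) →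
                        dot (extend z β) (hyperplane z y) ≡ dot β y
dot-extend-hyperplane here      β       y       = refl
dot-extend-hyperplane (there z) (b ∷ β) (c ∷ y) =
  cong ((b ∧ c) xor_) (dot-extend-hyperplane z β y)

card-hyperplane : ∀ {r} {a : Vec Bool r} (z : Pivot a) (p : Vec Bool r → Bool) →
                  card r (λ x → p x ∧ not (dot a x)) ≡ card (pred r) (p ∘ hyperplane z)
card-hyperplane {suc n} (here {v = a}) p = card-+ n split
  where
  split : ∀ v → indicator (p (false ∷ v) ∧ not (dot a v))
                + indicator (p (true ∷ v) ∧ not (not (dot a v)))
              ≡ indicator (p (dot a v ∷ v))
  split v with dot a v
  ... | false = trans (cong₂ _+_ (cong indicator (∧-identityʳ _)) (cong indicator (∧-zeroʳ _)))
                      (+-identityʳ _)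
  ... | true  = cong₂ _+_ (cong indicator (∧-zeroʳ _)) (cong indicator (∧-identityʳ _))
card-hyperplane (there z) p =
  cong₂ _+_ (card-hyperplane z (p ∘ (false ∷_))) (card-hyperplane z (p ∘ (true ∷_)))

few-on-hyperplane : ∀ {r} {a : Vec Bool r} (z : Pivot a) (p : Vec Bool r → Bool) (d : ℕ) →
                    count (λ x → p x ∧ not (dot a x)) * 2 ^ suc d < 2 ^ r →
                    card (pred r) (p ∘ hyperplane z) * 2 ^ d < 2 ^ pred r
few-on-hyperplane {r} {a} z p d few = *-cancelˡ-< 2 _ _ (begin-strict
  2 * (C * 2 ^ d)                                ≡⟨ *-assoc 2 C (2 ^ d) ⟨
  2 * C * 2 ^ d                                  ≡⟨ cong (_* 2 ^ d) (*-comm 2 C) ⟩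
  C * 2 * 2 ^ d                                  ≡⟨ *-assoc C 2 (2 ^ d) ⟩
  C * 2 ^ suc d                                  ≡⟨ cong (_* 2 ^ suc d) (card-hyperplane z p) ⟨
  card r (λ x → p x ∧ not (dot a x)) * 2 ^ suc d ≡⟨ cong (_* 2 ^ suc d) (count≡card {r} _) ⟨
  count (λ x → p x ∧ not (dot a x)) * 2 ^ suc d  <⟨ few ⟩
  2 ^ r                                          ≡⟨ 2^-pivot z ⟩
  2 * 2 ^ pred r                                 ∎)
  where
  open ≤-Reasoning
  C : ℕ
  C = card (pred r) (p ∘ hyperplane z)

Spans : ∀ {n} → (Vec Bool n → Bool) → Set
Spans {n} p =
  (v : Vec Bool n) → Σ (List (Vec Bool n)) λ xs → All (λ x → p x ≡ true) xs × sumᵥ xs ≡ v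

-- Each v is  x + (x + v)  for some x with both summands in p.
dense⇒spans : ∀ {n} (p : Vec Bool n → Bool) → 2 * card n (not ∘ p) < 2 ^ n → Spans p
dense⇒spans {n} p few v =
  x ∷ (x ⊕ v) ∷ [] ,
  not-injective (∨-conicalˡ _ _ bad) ∷ not-injective (∨-conicalʳ _ _ bad) ∷ [] ,
  sum≡v
  where
  C : ℕ
  C = card n (not ∘ p)
  pair-few : card n (λ x → not (p x) ∨ not (p (x ⊕ v))) < 2 ^ n
  pair-few = begin-strict
    card n (λ x → not (p x) ∨ not (p (x ⊕ v))) ≤⟨ card-∨ n _ _ ⟩
    C + card n (λ x → not (p (x ⊕ v)))          ≡⟨ cong (C +_) (card-⊕ n (not ∘ p) v) ⟩
    C + C                                       ≡⟨ cong (C +_) (+-identityʳ C) ⟨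
    2 * C                                       <⟨ few ⟩
    2 ^ n                                       ∎
    where open ≤-Reasoning
  x : Vec Bool n
  x = proj₁ (card<2^n⇒∃false n _ pair-few)
  bad : not (p x) ∨ not (p (x ⊕ v)) ≡ false
  bad = proj₂ (card<2^n⇒∃false n _ pair-few)
  sum≡v : x ⊕ ((x ⊕ v) ⊕ 0ᵥ n) ≡ v
  sum≡v = trans (cong (x ⊕_) (⊕-identityʳ (x ⊕ v))) (⊕-cancelˡ x v)

restriction : (M : Matroid) {a : Vec Bool (rank M)} (z : Pivot a) →
              Spans (E M ∘ hyperplane z) → Matroid
restriction M z spans′ = record
  { rank   = pred (rank M)
  ; E      = E M ∘ hyperplane z
  ; zero∉E = trans (cong (E M) (linear-0 (hyperplane-linear z))) (zero∉E M)
  ; spans  = spans′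
  }

Contains-embed : ∀ {N} (M′ M : Matroid) {f : Vec Bool (rank M′) → Vec Bool (rank M)} →
                 Linear f → TrivialKernel f → (∀ x → E M′ x ≡ true → E M (f x) ≡ true) →
                 Contains M′ N → Contains M N
Contains-embed M′ M {f} lin ker E′⊆E (ι , indep , inE′) =
  map f ι , LinIndep-map lin ker ι indep ,
  λ x x∈N → subst (λ w → E M w ≡ true) (sym (comb-map lin ι x)) (E′⊆E _ (inE′ x x∈N))

Contains-restriction : ∀ {N} (M : Matroid) {a : Vec Bool (rank M)} (z : Pivot a)
                       (spans′ : Spans (E M ∘ hyperplane z)) →
                       Contains (restriction M z spans′) N → Contains M N
Contains-restriction {N} M z spans′ =
  Contains-embed {N} (restriction M z spans′) M
                 (hyperplane-linear z) (hyperplane-kernel z) (λ _ x∈E → x∈E)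

Contains-PG-suc : (M : Matroid) {d : ℕ} → card (rank M) (not ∘ E M) * 2 ^ d < 2 ^ rank M →
                  Contains M (PG d) → Contains M (PG (suc d))
Contains-PG-suc M few (ι , indep , inE) = u ∷ ι , indep′ , inE′
  where
  avoiding : ∃ λ u → ∀ c → not (E M (u ⊕ comb ι c)) ≡ false
  avoiding = ∃-avoiding (λ u c → not (E M (u ⊕ comb ι c)))
                        (λ c → ≤-reflexive (card-⊕ (rank M) (not ∘ E M) (comb ι c))) few
  u : Vec Bool (rank M)
  u = proj₁ avoiding
  coset⊆E : ∀ c → E M (u ⊕ comb ι c) ≡ true
  coset⊆E c = not-injective (proj₂ avoiding c)
  indep′ : LinIndep (u ∷ ι)
  indep′ (false ∷ c) eq = cong (false ∷_) (indep c eq)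
  indep′ (true ∷ c)  eq =
    contradiction (trans (sym (coset⊆E c)) (trans (cong (E M) eq) (zero∉E M))) λ ()
  inE′ : ∀ x → not (isZero x) ≡ true → E M (comb (u ∷ ι) x) ≡ true
  inE′ (false ∷ c) x≢0 = inE c x≢0
  inE′ (true ∷ c)  _   = coset⊆E c

few-missing⇒dense : (M : Matroid) (d : ℕ) → card (rank M) (not ∘ E M) * 2 ^ d < 2 ^ rank M →
                    2 ^ d * 2 ^ rank M < size M * 2 ^ d + 3 * 2 ^ rank M
few-missing⇒dense M d few = begin-strict
  2 ^ d * 2 ^ r          ≡⟨ *-comm (2 ^ d) (2 ^ r) ⟩
  2 ^ r * 2 ^ d          ≡⟨ cong (_* 2 ^ d) (card-complement r (E M)) ⟨
  (S + C) * 2 ^ d        ≡⟨ *-distribʳ-+ (2 ^ d) S C ⟩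
  S * 2 ^ d + C * 2 ^ d  <⟨ +-monoʳ-< (S * 2 ^ d) few ⟩
  S * 2 ^ d + 2 ^ r      ≤⟨ +-monoʳ-≤ (S * 2 ^ d) (m≤n*m (2 ^ r) 3) ⟩
  S * 2 ^ d + 3 * 2 ^ r  ≡⟨ cong (λ s → s * 2 ^ d + 3 * 2 ^ r) (count≡card (E M)) ⟨
  size M * 2 ^ d + 3 * 2 ^ r ∎
  where
  open ≤-Reasoning
  r S C : ℕ
  r = rank M
  S = card r (E M)
  C = card r (not ∘ E M)

inKernel-extend : ∀ {r k} {a : Vec Bool r} (z : Pivot a)
                  (βs : Vec (Vec Bool (pred r)) k) (y : Vec Bool (pred r)) →
                  inKernel (map (extend z) βs) (hyperplane z y) → inKernel βs y
inKernel-extend z []       y tt          = tt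
inKernel-extend z (β ∷ βs) y (β·y≡0 , rest) =
  trans (sym (dot-extend-hyperplane z β y)) β·y≡0 , inKernel-extend z βs y rest

HasDisjointSubspaceOfCodim-restriction :
  (M : Matroid) {a : Vec Bool (rank M)} (z : Pivot a) (spans′ : Spans (E M ∘ hyperplane z))
  {k : ℕ} →
  HasDisjointSubspaceOfCodim (restriction M z spans′) k → HasDisjointSubspaceOfCodim M (suc k)
HasDisjointSubspaceOfCodim-restriction M {a} z spans′ (βs , indep , disjoint) =
  a ∷ αs , indep′ , disjoint′
  where
  αs : Vec (Vec Bool (rank M)) _
  αs = map (extend z) βs
  indep′ : LinIndep (a ∷ αs)
  indep′ (false ∷ c) eq =
    cong (false ∷_) (LinIndep-map (extend-linear z) (extend-kernel z) βs indep c eq)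
  indep′ (true ∷ c)  eq =
    ⊥-elim (extend≢ z (comb βs c) (sym (trans (⊕≡0⇒≡ eq) (comb-map (extend-linear z) βs c))))
  disjoint′ : ∀ x → inKernel (a ∷ αs) x → E M x ≡ false
  disjoint′ x (a·x≡0 , x∈ker) =
    let y , y↦x = hyperplane-surjective z x a·x≡0
    in subst (λ w → E M w ≡ false) y↦x
             (disjoint y (inKernel-extend z βs y (subst (inKernel αs) (sym y↦x) x∈ker)))

-- No decidability of P is needed: by strong induction, a witness ≤ t would be a least one.
least-above⇒all-above : ∀ {ℓ} {P : ℕ → Set ℓ} (t : ℕ) →
                        (∀ k → P k → (∀ j → j < k → ¬ P j) → t < k) → ∀ k → P k → t < k
least-above⇒all-above {P = P} t least-above = <-rec (λ k → P k → t < k) step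
  where
  step : ∀ k → (∀ {j} → j < k → P j → t < j) → P k → t < k
  step k rec Pk with t <? k
  ... | yes t<k = t<k
  ... | no  t≮k = least-above k Pk λ j j<k Pj →
                    <⇒≱ (rec j<k Pj) (≤-trans (<⇒≤ j<k) (≮⇒≥ t≮k))

corollary4p2 : (t : ℕ) → 3 ≤ t →
    ((M' : Matroid) → Free M' (PG (t ∸ 1)) →
    2 ^ (t ∸ 1) * 2 ^ rank M' < size M' * 2 ^ (t ∸ 1) + 3 * 2 ^ rank M' →
    IsCriticalNumber M' (t ∸ 2) ⊎ IsCriticalNumber M' (t ∸ 1)) →
    (M : Matroid) → Free M (PG t) →
    2 ^ t * 2 ^ rank M < size M * 2 ^ t + 3 * 2 ^ rank M →
    ((k : ℕ) → IsCriticalNumber M k → t < k) →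
    (a : Vec Bool (rank M)) → a ≢ 0ᵥ (rank M) →
    2 ^ rank M ≤ count (λ x → not (E M x) ∧ not (dot a x)) * 2 ^ t
corollary4p2 (suc (suc (suc e))) (s≤s (s≤s (s≤s _))) hyp M PG-free _ χ>t a a≢0 =
  ≮⇒≥ few-contradiction
  where
  d : ℕ
  d = suc (suc e)
  z : Pivot a
  z = pivot a a≢0
  C : ℕ
  C = card (pred (rank M)) (not ∘ E M ∘ hyperplane z)
  2C≤C*2^d : 2 * C ≤ C * 2 ^ d
  2C≤C*2^d = ≤-trans (≤-reflexive (*-comm 2 C))
                     (*-monoʳ-≤ C (^-monoʳ-≤ 2 {1} {d} (s≤s z≤n)))

  few-contradiction : ¬ count (λ x → not (E M x) ∧ not (dot a x)) * 2 ^ suc d < 2 ^ rank M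
  few-contradiction few =
    <⇒≱ (least-above⇒all-above (suc d) χ>t′ (suc k) disjoint) (s≤s k≤d)
    where
    few′ : C * 2 ^ d < 2 ^ pred (rank M)
    few′ = few-on-hyperplane z (not ∘ E M) d few
    spans′ : Spans (E M ∘ hyperplane z)
    spans′ = dense⇒spans _ (≤-<-trans 2C≤C*2^d few′)
    M′ : Matroid
    M′ = restriction M z spans′
    PG-free′ : Free M′ (PG d)
    PG-free′ = PG-free ∘ Contains-restriction {PG (suc d)} M z spans′
                       ∘ Contains-PG-suc M′ few′
    disjoint′ : Σ ℕ λ k → k ≤ d × HasDisjointSubspaceOfCodim M′ k
    disjoint′ = [ (λ χ′ → suc e , n≤1+n (suc e) , proj₁ χ′)
                , (λ χ′ → d , ≤-refl , proj₁ χ′) ]′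
                  (hyp M′ PG-free′ (few-missing⇒dense M′ d few′))
    k : ℕ
    k = proj₁ disjoint′
    k≤d : k ≤ d
    k≤d = proj₁ (proj₂ disjoint′)
    disjoint : HasDisjointSubspaceOfCodim M (suc k)
    disjoint = HasDisjointSubspaceOfCodim-restriction M z spans′ (proj₂ (proj₂ disjoint′))
    χ>t′ : ∀ k → HasDisjointSubspaceOfCodim M k →
           (∀ j → j < k → ¬ HasDisjointSubspaceOfCodim M j) → suc d < k
    χ>t′ k disjoint minimal = χ>t k (disjoint , minimal)
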